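{- Let $n\ge 1$. In \textsc{Closed Geodetic Game} played under optimal play on the complete graph $K_n$, or on the star $K_{1,n}$ (one centre adjacent to $n$ leaves), every vertex of the graph gets selected.
   Context: For vertices $x,y$, $\mathcal{I}(x,y)$ is the set of vertices on some shortest $x$–$y$ path ($\mathcal{I}(x,x)=\{x\}$); for a vertex set $S$, the geodetic closure is $(S)=\bigcup_{x,y\in S}\mathcal{I}(x,y)$. \textsc{Closed Geodetic Game}: starting from $S=\emptyset$, two players alternately add to $S$ a vertex not in the current closure $(S)$; the game ends when $(S)$ is the whole vertex set, and the player who made the last move wins. Optimal play means: a player who has a winning strategy applies one that wins using as few rounds as possible, and a player with no winning strategy tries to make the game last as long as possible. -}

module Defs where

open import Data.Nat using (ℕ; zero; suc; _≤_)
open import Data.Fin using (Fin; zero; suc; fromℕ; inject₁)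
open import Data.List using (List; []; _∷_)
open import Data.List.Membership.Propositional using (_∈_)
open import Data.Product using (Σ; ∃; _×_; _,_)
open import Data.Unit using (⊤)
open import Data.Empty using (⊥)
open import Relation.Nullary using (¬_)
open import Relation.Binary.PropositionalEquality using (_≡_; _≢_)

record Graph : Set₁ where
  field
    size : ℕ
    Adj  : Fin size → Fin size → Set
open Graph public

K : ℕ → Graph
K n = record { size = n ; Adj = λ i j → i ≢ j }

-- star K_{1,n} : vertex zero is the centre, vertices suc i are the n leaves
StarAdj : ∀ {n} → Fin (suc n) → Fin (suc n) → Set
StarAdj zero    zero    = ⊥
StarAdj zero    (suc _) = ⊤
StarAdj (suc _) zero    = ⊤
StarAdj (suc _) (suc _) = ⊥

Star : ℕ → Graph
Star n = record { size = suc n ; Adj = StarAdj }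

module _ (G : Graph) where
  private
    V = Fin (size G)

  record Walk (x y : V) (k : ℕ) : Set where
    field
      vert  : Fin (suc k) → V
      start : vert zero ≡ x
      end   : vert (fromℕ k) ≡ y
      steps : (i : Fin k) → Adj G (vert (inject₁ i)) (vert (suc i))
  open Walk public

  record ShortestPath (x y : V) : Set where
    field
      len      : ℕ
      walk     : Walk x y len
      shortest : ∀ j → Walk x y j → len ≤ j
  open ShortestPath public

  Interval : V → V → V → Set
  Interval x y z = Σ (ShortestPath x y) λ P → ∃ λ i → vert (walk P) i ≡ z

  Closure : List V → V → Set
  Closure S z = ∃ λ x → ∃ λ y → x ∈ S × y ∈ S × Interval x y z

  Terminal : List V → Set
  Terminal S = ∀ z → Closure S z

  Legal : List V → V → Set
  Legal S v = ¬ Closure S v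

-- A result is given from the point of view of the player to move:
-- win k  = this player wins and the game lasts k more moves;
-- lose k = this player loses and the game lasts k more moves.

data Result : Set where
  win  : ℕ → Result
  lose : ℕ → Result

-- r ⊑ r' : r is at most as good as r' for the player to move
-- (winning beats losing; a faster win is better; a longer loss is better)
data _⊑_ : Result → Result → Set where
  lose⊑win  : ∀ {a b} → lose a ⊑ win b
  win⊑win   : ∀ {a b} → b ≤ a → win a ⊑ win b
  lose⊑lose : ∀ {a b} → a ≤ b → lose a ⊑ lose b

-- result for the mover, given the result for the opponent after one move
step : Result → Result
step (win k)  = lose (suc k)
step (lose k) = win (suc k)

module _ (G : Graph) where
  private
    V = Fin (size G)

  -- Value S r : under optimal play from position S (vertices selected so
  -- far), the result for the player to move is r.
  data Value (S : List V) : Result → Set where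
    terminal : Terminal G S → Value S (lose 0)
    best     : ∀ {r} (v : V) → Legal G S v → Value (v ∷ S) r →
               (∀ w → Legal G S w → Σ Result λ r' → Value (w ∷ S) r' × step r' ⊑ step r) →
               Value S (step r)

  OptimalMove : List V → V → Set
  OptimalMove S v = Legal G S v × ∃ λ r → Value (v ∷ S) r × Value S (step r)

  -- OptimalPlay S T : a complete play from S, all moves optimal, ending
  -- in the terminal position T (the list of all selected vertices)
  data OptimalPlay : List V → List V → Set where
    done  : ∀ {S} → Terminal G S → OptimalPlay S S
    move  : ∀ {S T} (v : V) → OptimalMove S v → OptimalPlay (v ∷ S) T → OptimalPlay S T

  AllSelectedUnderOptimalPlay : Set
  AllSelectedUnderOptimalPlay =
    (∃ λ T → OptimalPlay [] T) × (∀ T → OptimalPlay [] T → ∀ z → z ∈ T)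

{-# OPTIONS --safe #-}
module Submission where

-- Every vertex of K_n and every leaf of the star is extreme: it enters the geodetic closure
-- only by being selected. Once all other vertices are closed, each legal move selects one new
-- extreme vertex and closes nothing else, so whatever the players do, the game lasts exactly
-- as many more moves as there are unselected extreme vertices. On K_n this already shows that
-- every play selects all n vertices.
--
-- On the star, opening with the centre forces a game of n + 1 moves, and after a leaf opening
-- the opponent can reply with the centre and force the same length; so the value of the empty
-- position is that of an (n + 1)-move game. Values are unique and optimal moves realise them,
-- but after two leaf openings the centre is closed and the game lasts only n moves in total.
-- Hence an optimal play selects the centre within its first two moves.

open import Defs
open import Level using (Level; 0ℓ)
open import Function using (_∘_; id)
open import Data.Nat using (ℕ; zero; suc; _≥_; _≤_; z≤n; s≤s)
open import Data.Nat.Properties using (≤-refl; ≤-antisym; ≤-total; ≤-trans; suc-injective; 0≢1+n; 1+n≢n)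
open import Data.Fin using (Fin; zero; suc)
import Data.Fin.Properties as Fin
open import Data.Bool using (if_then_else_)
open import Data.List using (List; []; _∷_; [_])
open import Data.List.Membership.Propositional using (_∈_; _∉_)
open import Data.List.Relation.Binary.Subset.Propositional using (_⊆_)
open import Data.List.Relation.Unary.Any using (here; there)
open import Data.Product using (Σ; ∃; _×_; _,_; proj₁; proj₂)
open import Data.Sum using (_⊎_; inj₁; inj₂)
import Data.Sum as Sum
open import Data.Empty using (⊥; ⊥-elim)
open import Data.Unit using (⊤; tt)
open import Relation.Nullary using (¬_; yes; no; does; ¬?; _×-dec_)
open import Relation.Unary using (Pred; Decidable; Universal; Empty; Satisfiable; _≐_)
open import Relation.Unary.Properties using (U?)
open import Relation.Binary.PropositionalEquality
  using (_≡_; _≢_; refl; sym; trans; cong; subst; subst₂; module ≡-Reasoning)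

private variable
  k m : ℕ
  p q : Level

count : {P : Pred (Fin k) p} → Decidable P → ℕ
count {k = zero}  P? = 0
count {k = suc k} P? = (if does (P? zero) then suc else id) (count (P? ∘ suc))

count-cong : {P : Pred (Fin k) p} {Q : Pred (Fin k) q} (P? : Decidable P) (Q? : Decidable Q) →
             P ≐ Q → count P? ≡ count Q?
count-cong {k = zero}  _  _  _ = refl
count-cong {k = suc k} P? Q? (P⊆Q , Q⊆P) with P? zero | Q? zero
... | yes _  | yes _  = cong suc (count-cong (P? ∘ suc) (Q? ∘ suc) (P⊆Q , Q⊆P))
... | no _   | no _   = count-cong (P? ∘ suc) (Q? ∘ suc) (P⊆Q , Q⊆P)
... | yes p₀ | no ¬q₀ = ⊥-elim (¬q₀ (P⊆Q p₀))
... | no ¬p₀ | yes q₀ = ⊥-elim (¬p₀ (Q⊆P q₀))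

count-universal : {P : Pred (Fin k) p} (P? : Decidable P) → Universal P → count P? ≡ k
count-universal {k = zero}  _  _   = refl
count-universal {k = suc k} P? all with P? zero
... | yes _  = cong suc (count-universal (P? ∘ suc) (all ∘ suc))
... | no ¬p₀ = ⊥-elim (¬p₀ (all zero))

count≡0⇒Empty : {P : Pred (Fin k) p} (P? : Decidable P) → count P? ≡ 0 → Empty P
count≡0⇒Empty {k = suc k} P? eq i with P? zero
count≡0⇒Empty {k = suc k} P? () i       | yes _
count≡0⇒Empty {k = suc k} P? eq zero    | no ¬p₀ = ¬p₀
count≡0⇒Empty {k = suc k} P? eq (suc i) | no _   = count≡0⇒Empty (P? ∘ suc) eq i

count≡suc⇒Satisfiable : {P : Pred (Fin k) p} (P? : Decidable P) → count P? ≡ suc m → Satisfiable P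
count≡suc⇒Satisfiable {k = suc k} P? eq with P? zero
... | yes p₀ = zero , p₀
... | no _   = let i , pᵢ = count≡suc⇒Satisfiable (P? ∘ suc) eq in suc i , pᵢ

count-remove : {P : Pred (Fin k) p} {Q : Pred (Fin k) q} (P? : Decidable P) (Q? : Decidable Q) {w : Fin k} →
               P w → Q ≐ (λ i → P i × i ≢ w) → count P? ≡ suc (count Q?)
count-remove {k = suc k} P? Q? {zero} p₀ (Q⊆ , ⊆Q) with P? zero | Q? zero
... | yes _  | no _   =
  cong suc (count-cong (P? ∘ suc) (Q? ∘ suc) ((λ pᵢ → ⊆Q (pᵢ , λ ())) , proj₁ ∘ Q⊆))
... | no ¬p₀ | _      = ⊥-elim (¬p₀ p₀)
... | _      | yes q₀ = ⊥-elim (proj₂ (Q⊆ q₀) refl)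
count-remove {k = suc k} {P = P} {Q = Q} P? Q? {suc w} pw (Q⊆ , ⊆Q) = at-head
  where
  shifted : (λ i → Q (suc i)) ≐ (λ i → P (suc i) × i ≢ w)
  shifted = (λ qᵢ → let pᵢ , i≢w = Q⊆ qᵢ in pᵢ , i≢w ∘ cong suc)
          , (λ (pᵢ , i≢w) → ⊆Q (pᵢ , i≢w ∘ Fin.suc-injective))
  rest : count (P? ∘ suc) ≡ suc (count (Q? ∘ suc))
  rest = count-remove (P? ∘ suc) (Q? ∘ suc) pw shifted
  at-head : count P? ≡ suc (count Q?)
  at-head with P? zero | Q? zero
  ... | yes _  | yes _  = cong suc rest
  ... | no _   | no _   = rest
  ... | yes p₀ | no ¬q₀ = ⊥-elim (¬q₀ (⊆Q (p₀ , λ ())))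
  ... | no ¬p₀ | yes q₀ = ⊥-elim (¬p₀ (proj₁ (Q⊆ q₀)))

outcome : ℕ → Result
outcome zero    = lose 0
outcome (suc m) = step (outcome m)

duration : Result → ℕ
duration (win k)  = k
duration (lose k) = k

duration-step : ∀ r → duration (step r) ≡ suc (duration r)
duration-step (win _)  = refl
duration-step (lose _) = refl

duration-outcome : ∀ m → duration (outcome m) ≡ m
duration-outcome zero    = refl
duration-outcome (suc m) = trans (duration-step (outcome m)) (cong suc (duration-outcome m))

outcome-injective : ∀ {m n} → outcome m ≡ outcome n → m ≡ n
outcome-injective {m} {n} eq = begin
  m                    ≡⟨ duration-outcome m ⟨
  duration (outcome m) ≡⟨ cong duration eq ⟩
  duration (outcome n) ≡⟨ duration-outcome n ⟩
  n                    ∎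
  where open ≡-Reasoning

⊑-refl : ∀ r → r ⊑ r
⊑-refl (win _)  = win⊑win ≤-refl
⊑-refl (lose _) = lose⊑lose ≤-refl

⊑-antisym : ∀ {r s} → r ⊑ s → s ⊑ r → r ≡ s
⊑-antisym lose⊑win          ()
⊑-antisym (win⊑win b≤a)     (win⊑win a≤b)     = cong win (≤-antisym a≤b b≤a)
⊑-antisym (lose⊑lose a≤b)   (lose⊑lose b≤a)   = cong lose (≤-antisym a≤b b≤a)

⊑-total : ∀ r s → r ⊑ s ⊎ s ⊑ r
⊑-total (win a)  (win b)  = Sum.map win⊑win win⊑win (≤-total b a)
⊑-total (win _)  (lose _) = inj₂ lose⊑win
⊑-total (lose _) (win _)  = inj₁ lose⊑win
⊑-total (lose a) (lose b) = Sum.map lose⊑lose lose⊑lose (≤-total a b)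

step-antitone : ∀ {r s} → r ⊑ s → step s ⊑ step r
step-antitone lose⊑win        = lose⊑win
step-antitone (win⊑win b≤a)   = lose⊑lose (s≤s b≤a)
step-antitone (lose⊑lose a≤b) = win⊑win (s≤s a≤b)

module Play (G : Graph) where
  private
    V = Fin (size G)
    open import Data.List.Membership.DecPropositional (Fin._≟_ {size G}) using (_∈?_)

  walk₀ : (x : V) → Walk G x x 0
  walk₀ x = record { vert = λ _ → x ; start = refl ; end = refl ; steps = λ () }

  walk₁ : ∀ {x y} → Adj G x y → Walk G x y 1
  walk₁ {x} {y} xy = record
    { vert = λ { zero → x ; (suc _) → y } ; start = refl ; end = refl ; steps = λ { zero → xy } }

  walk₂ : ∀ {x y z} → Adj G x y → Adj G y z → Walk G x z 2
  walk₂ {x} {y} {z} xy yz = record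
    { vert  = λ { zero → x ; (suc zero) → y ; (suc (suc _)) → z }
    ; start = refl ; end = refl ; steps = λ { zero → xy ; (suc zero) → yz } }

  walk≤1-vertices : ∀ {x y k} (w : Walk G x y k) → k ≤ 1 → ∀ i → vert w i ≡ x ⊎ vert w i ≡ y
  walk≤1-vertices w z≤n       zero       = inj₁ (start w)
  walk≤1-vertices w (s≤s z≤n) zero       = inj₁ (start w)
  walk≤1-vertices w (s≤s z≤n) (suc zero) = inj₂ (end w)

  Interval⊆endpoints : ∀ {x y z k} → Walk G x y k → k ≤ 1 → Interval G x y z → z ≡ x ⊎ z ≡ y
  Interval⊆endpoints w k≤1 (P , i , vᵢ≡z) =
    Sum.map (trans (sym vᵢ≡z)) (trans (sym vᵢ≡z))
            (walk≤1-vertices (walk P) (≤-trans (shortest P _ w) k≤1) i)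

  Closure-∈ : ∀ {S z} → z ∈ S → Closure G S z
  Closure-∈ {z = z} z∈S =
    z , z , z∈S , z∈S , record { len = 0 ; walk = walk₀ z ; shortest = λ _ _ → z≤n } , zero , refl

  Closure-∷ : ∀ {S w z} → Closure G S z → Closure G (w ∷ S) z
  Closure-∷ (x , y , x∈S , y∈S , I) = x , y , there x∈S , there y∈S , I

  Closure-[] : ∀ {z} → ¬ Closure G [] z
  Closure-[] (_ , _ , () , _)

  Legal⇒∉ : ∀ {S z} → Legal G S z → z ∉ S
  Legal⇒∉ legal = legal ∘ Closure-∈

  Extreme : V → Set
  Extreme z = ∀ {x y} → Interval G x y z → z ≡ x ⊎ z ≡ y

  Extreme-Closure⇒∈ : ∀ {S z} → Extreme z → Closure G S z → z ∈ S
  Extreme-Closure⇒∈ extreme (x , y , x∈S , y∈S , I) with extreme I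
  ... | inj₁ refl = x∈S
  ... | inj₂ refl = y∈S

  Value-unique : ∀ {S r s} → Value G S r → Value G S s → r ≡ s
  Value-unique (terminal _)      (terminal _)      = refl
  Value-unique (terminal closed) (best v lv _ _)   = ⊥-elim (lv (closed v))
  Value-unique (best v lv _ _)   (terminal closed) = ⊥-elim (lv (closed v))
  Value-unique (best v lv d replies) (best v′ lv′ d′ replies′) =
    ⊑-antisym (dominated d (replies′ v lv)) (dominated d′ (replies v′ lv′))
    where
    dominated : ∀ {T a b} → Value G T a → (Σ Result λ c → Value G T c × step c ⊑ b) → step a ⊑ b
    dominated da (c , dc , le) = subst (λ x → step x ⊑ _) (sym (Value-unique da dc)) le

  data Lasts (S : List V) : ℕ → Set where
    over : Terminal G S → Lasts S 0
    next : ∀ {m} v → Legal G S v → (∀ w → Legal G S w → Lasts (w ∷ S) m) → Lasts S (suc m)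

  Lasts⇒Value : ∀ {S m} → Lasts S m → Value G S (outcome m)
  Lasts⇒Value (over t) = terminal t
  Lasts⇒Value {m = suc m} (next v lv after) =
    best v lv (Lasts⇒Value (after v lv)) (λ w lw → outcome m , Lasts⇒Value (after w lw) , ⊑-refl _)

  Lasts⇒OptimalPlay : ∀ {S m} → Lasts S m → ∃ (OptimalPlay G S)
  Lasts⇒OptimalPlay {S} (over t) = S , done t
  Lasts⇒OptimalPlay {m = suc m} l@(next v lv after) =
    let T , play = Lasts⇒OptimalPlay (after v lv)
    in  T , move v (lv , outcome m , Lasts⇒Value (after v lv) , Lasts⇒Value l) play

  OptimalPlay⇒Terminal : ∀ {S T} → OptimalPlay G S T → Terminal G T
  OptimalPlay⇒Terminal (done t)        = t
  OptimalPlay⇒Terminal (move _ _ play) = OptimalPlay⇒Terminal play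

  OptimalPlay⇒⊆ : ∀ {S T} → OptimalPlay G S T → S ⊆ T
  OptimalPlay⇒⊆ (done _)        = id
  OptimalPlay⇒⊆ (move _ _ play) = OptimalPlay⇒⊆ play ∘ there

  module ExtremeVertices {E : Pred V 0ℓ} (E? : Decidable E) (E⇒Extreme : ∀ {z} → E z → Extreme z) where

    Unselected : List V → Pred V 0ℓ
    Unselected S z = E z × z ∉ S

    Unselected? : ∀ S → Decidable (Unselected S)
    Unselected? S z = E? z ×-dec ¬? (z ∈? S)

    unselected : List V → ℕ
    unselected S = count (Unselected? S)

    unselected-[] : unselected [] ≡ count E?
    unselected-[] = count-cong (Unselected? []) E? (proj₁ , λ e → e , λ ())

    unselected-∷ : ∀ {S w} → E w → w ∉ S → unselected S ≡ suc (unselected (w ∷ S))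
    unselected-∷ {S} {w} e w∉S = count-remove (Unselected? S) (Unselected? (w ∷ S)) (e , w∉S)
      ( (λ (e , z∉wS) → (e , z∉wS ∘ there) , z∉wS ∘ here)
      , (λ ((e , z∉S) , z≢w) → e , λ { (here z≡w) → z≢w z≡w ; (there z∈S) → z∉S z∈S }) )

    unselected-∷-¬E : ∀ {S w} → ¬ E w → unselected (w ∷ S) ≡ unselected S
    unselected-∷-¬E {S} {w} ¬e = count-cong (Unselected? (w ∷ S)) (Unselected? S)
      ( (λ (e , z∉wS) → e , z∉wS ∘ there)
      , (λ (e , z∉S) → e , λ { (here refl) → ¬e e ; (there z∈S) → z∉S z∈S }) )

    ClosesOutsideE : List V → Set
    ClosesOutsideE S = ∀ z → ¬ E z → Closure G S z

    Legal⇒Unselected : ∀ {S z} → ClosesOutsideE S → Legal G S z → Unselected S z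
    Legal⇒Unselected {z = z} closes legal with E? z
    ... | yes e  = e , Legal⇒∉ legal
    ... | no ¬e  = ⊥-elim (legal (closes z ¬e))

    Unselected⇒Legal : ∀ {S z} → Unselected S z → Legal G S z
    Unselected⇒Legal (e , z∉S) = z∉S ∘ Extreme-Closure⇒∈ (E⇒Extreme e)

    Lasts-unselected : ∀ {S} → ClosesOutsideE S → Lasts S (unselected S)
    Lasts-unselected closes₀ = lasts _ closes₀ refl
      where
      lasts : ∀ m {S} → ClosesOutsideE S → unselected S ≡ m → Lasts S m
      lasts zero {S} closes none = over closed
        where
        closed : Terminal G S
        closed z with E? z | z ∈? S
        ... | no ¬e | _        = closes z ¬e
        ... | yes _ | yes z∈S  = Closure-∈ z∈S
        ... | yes e | no z∉S   = ⊥-elim (count≡0⇒Empty (Unselected? S) none z (e , z∉S))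
      lasts (suc m) {S} closes eq =
        let v , unselected-v = count≡suc⇒Satisfiable (Unselected? S) eq
        in  next v (Unselected⇒Legal unselected-v) after
        where
        after : ∀ w → Legal G S w → Lasts (w ∷ S) m
        after w legal =
          let e , w∉S = Legal⇒Unselected closes legal
          in  lasts m (λ z ¬e → Closure-∷ (closes z ¬e))
                      (suc-injective (trans (sym (unselected-∷ e w∉S)) eq))

module _ (n : ℕ) where
  open Play (K n)

  K-walk : ∀ x y → ∃ λ k → k ≤ 1 × Walk (K n) x y k
  K-walk x y with x Fin.≟ y
  ... | yes refl = 0 , z≤n , walk₀ x
  ... | no x≢y   = 1 , s≤s z≤n , walk₁ x≢y

  K-extreme : ∀ {z} → Extreme z
  K-extreme {x = x} {y} = let k , k≤1 , w = K-walk x y in Interval⊆endpoints w k≤1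

  open ExtremeVertices U? (λ _ → K-extreme)

  K-AllSelected : AllSelectedUnderOptimalPlay (K n)
  K-AllSelected =
    Lasts⇒OptimalPlay (Lasts-unselected (λ _ ¬⊤ → ⊥-elim (¬⊤ tt))) ,
    λ _ play z → Extreme-Closure⇒∈ K-extreme (OptimalPlay⇒Terminal play z)

pattern centre = zero
pattern leaf ℓ = suc ℓ

module _ (n : ℕ) where
  open Play (Star n)

  Leaf : Pred (Fin (suc n)) 0ℓ
  Leaf centre   = ⊥
  Leaf (leaf _) = ⊤

  Leaf? : Decidable Leaf
  Leaf? centre   = no λ ()
  Leaf? (leaf _) = yes tt

  star-walk : ∀ (x y : Fin (suc n)) → ∃ λ k → k ≤ 2 × Walk (Star n) x y k
  star-walk centre   centre   = 0 , z≤n , walk₀ centre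
  star-walk centre   (leaf _) = 1 , s≤s z≤n , walk₁ tt
  star-walk (leaf _) centre   = 1 , s≤s z≤n , walk₁ tt
  star-walk (leaf _) (leaf _) = 2 , s≤s (s≤s z≤n) , walk₂ {y = centre} tt tt

  leaf-neighbours : ∀ {u v : Fin (suc n)} {ℓ} → StarAdj u (leaf ℓ) → StarAdj (leaf ℓ) v →
                    u ≡ centre × v ≡ centre
  leaf-neighbours {centre}  {centre}  _ _ = refl , refl
  leaf-neighbours {centre}  {leaf _} _ ()
  leaf-neighbours {leaf _} {_}        () _

  leaf-extreme : ∀ {ℓ} → Extreme (leaf ℓ)
  leaf-extreme {ℓ} {x} {y} (P , i , vᵢ≡ℓ) =
    let k , k≤2 , w = star-walk x y
    in  on-geodesic (walk P) (≤-trans (shortest P k w) k≤2) (shortest P 0) i vᵢ≡ℓ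
    where
    on-geodesic : ∀ {m} (w : Walk (Star n) x y m) → m ≤ 2 → (Walk (Star n) x y 0 → m ≤ 0) →
                  ∀ i → vert w i ≡ leaf ℓ → leaf ℓ ≡ x ⊎ leaf ℓ ≡ y
    on-geodesic w _               _ zero             eq = inj₁ (trans (sym eq) (start w))
    on-geodesic w (s≤s z≤n)       _ (suc zero)       eq = inj₂ (trans (sym eq) (end w))
    on-geodesic w (s≤s (s≤s z≤n)) _ (suc (suc zero)) eq = inj₂ (trans (sym eq) (end w))
    on-geodesic w (s≤s (s≤s z≤n)) no-loop (suc zero) eq = ⊥-elim (2≰0 (no-loop loop))
      where
      ends : vert w zero ≡ centre × vert w (suc (suc zero)) ≡ centre
      ends = leaf-neighbours (subst (StarAdj (vert w zero)) eq (steps w zero))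
                             (subst (λ u → StarAdj u (vert w (suc (suc zero)))) eq (steps w (suc zero)))
      loop : Walk (Star n) x y 0
      loop = subst₂ (λ a b → Walk (Star n) a b 0)
                    (trans (sym (proj₁ ends)) (start w)) (trans (sym (proj₂ ends)) (end w)) (walk₀ centre)
      2≰0 : ¬ 2 ≤ 0
      2≰0 ()

  Leaf⇒Extreme : ∀ {z} → Leaf z → Extreme z
  Leaf⇒Extreme {leaf _} _ = leaf-extreme

  open ExtremeVertices Leaf? Leaf⇒Extreme

  centre-closes : ∀ {S} → Closure (Star n) S centre → ClosesOutsideE S
  centre-closes closed centre   _     = closed
  centre-closes _      (leaf _) ¬leaf = ⊥-elim (¬leaf tt)

  centre-between : ∀ {ℓ ℓ′} → ℓ ≢ ℓ′ → Interval (Star n) (leaf ℓ) (leaf ℓ′) centre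
  centre-between {ℓ} {ℓ′} ℓ≢ℓ′ =
    record { len = 2 ; walk = walk₂ tt tt ; shortest = no-shortcut } , suc zero , refl
    where
    no-shortcut : ∀ j → Walk (Star n) (leaf ℓ) (leaf ℓ′) j → 2 ≤ j
    no-shortcut zero          w = ⊥-elim (ℓ≢ℓ′ (Fin.suc-injective (trans (sym (start w)) (end w))))
    no-shortcut (suc zero)    w = ⊥-elim (subst₂ StarAdj (start w) (end w) (steps w zero))
    no-shortcut (suc (suc _)) _ = s≤s (s≤s z≤n)

  centre-legal-after-leaf : ∀ {ℓ} → Legal (Star n) [ leaf ℓ ] centre
  centre-legal-after-leaf {ℓ} (_ , _ , here refl , here refl , I)
    with Interval⊆endpoints (walk₀ (leaf ℓ)) z≤n I
  ... | inj₁ ()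
  ... | inj₂ ()

  unselected-[]≡n : unselected [] ≡ n
  unselected-[]≡n = trans unselected-[] (count-universal (Leaf? ∘ suc) (λ _ → tt))

  unselected-leaf : ∀ ℓ → suc (unselected [ leaf ℓ ]) ≡ n
  unselected-leaf ℓ = trans (sym (unselected-∷ tt λ ())) unselected-[]≡n

  unselected-leaf-leaf : ∀ {ℓ ℓ′} → Legal (Star n) [ leaf ℓ ] (leaf ℓ′) →
                         unselected [ leaf ℓ ] ≡ suc (unselected (leaf ℓ′ ∷ [ leaf ℓ ]))
  unselected-leaf-leaf legal = unselected-∷ tt (Legal⇒∉ legal)

  lasts-centre : Lasts [ centre ] n
  lasts-centre = subst (Lasts _) (trans (unselected-∷-¬E λ ()) unselected-[]≡n)
                       (Lasts-unselected (centre-closes (Closure-∈ (here refl))))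

  lasts-leaf-centre : ∀ {ℓ u} → unselected [ leaf ℓ ] ≡ u → Lasts (centre ∷ [ leaf ℓ ]) u
  lasts-leaf-centre eq = subst (Lasts _) (trans (unselected-∷-¬E λ ()) eq)
                               (Lasts-unselected (centre-closes (Closure-∈ (here refl))))

  lasts-leaf-leaf : ∀ {ℓ ℓ′} → Legal (Star n) [ leaf ℓ ] (leaf ℓ′) →
                    Lasts (leaf ℓ′ ∷ [ leaf ℓ ]) (unselected (leaf ℓ′ ∷ [ leaf ℓ ]))
  lasts-leaf-leaf {ℓ} {ℓ′} legal =
    Lasts-unselected (centre-closes (leaf ℓ′ , leaf ℓ , here refl , there (here refl) , between))
    where
    ℓ′≢ℓ : ℓ′ ≢ ℓ
    ℓ′≢ℓ refl = Legal⇒∉ legal (here refl)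
    between : Interval (Star n) (leaf ℓ′) (leaf ℓ) centre
    between = centre-between ℓ′≢ℓ

  another-leaf : ∀ {ℓ u} → unselected [ leaf ℓ ] ≡ suc u →
                 ∃ λ ℓ′ → Legal (Star n) [ leaf ℓ ] (leaf ℓ′)
  another-leaf {ℓ} eq with count≡suc⇒Satisfiable (Unselected? [ leaf ℓ ]) eq
  ... | leaf ℓ′ , unselected-ℓ′ = ℓ′ , Unselected⇒Legal unselected-ℓ′

  module _ (ℓ : Fin n) where
    AtLeast : Result → Set
    AtLeast r₀ = Σ Result λ r → Value (Star n) [ leaf ℓ ] r × r₀ ⊑ r

    private
      Replies : Result → Set
      Replies r = ∀ w → Legal (Star n) [ leaf ℓ ] w →
                  Σ Result λ r′ → Value (Star n) (w ∷ [ leaf ℓ ]) r′ × step r′ ⊑ r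

      lasts-leaf-leaf′ : ∀ {u ℓ′} → unselected [ leaf ℓ ] ≡ suc u →
                         Legal (Star n) [ leaf ℓ ] (leaf ℓ′) → Lasts (leaf ℓ′ ∷ [ leaf ℓ ]) u
      lasts-leaf-leaf′ eq legal =
        subst (Lasts _) (suc-injective (trans (sym (unselected-leaf-leaf legal)) eq)) (lasts-leaf-leaf legal)

      replies : ∀ {u r} → unselected [ leaf ℓ ] ≡ suc u →
                step (outcome (suc u)) ⊑ r → step (outcome u) ⊑ r → Replies r
      replies {u} eq centre⊑ _ centre    _     =
        outcome (suc u) , Lasts⇒Value (lasts-leaf-centre eq) , centre⊑
      replies {u} eq _ leaf⊑   (leaf ℓ′) legal =
        outcome u , Lasts⇒Value (lasts-leaf-leaf′ eq legal) , leaf⊑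

      last-reply : unselected [ leaf ℓ ] ≡ 0 → Replies (step (outcome 0))
      last-reply eq centre    _     = outcome 0 , Lasts⇒Value (lasts-leaf-centre eq) , ⊑-refl _
      last-reply eq (leaf ℓ′) legal = ⊥-elim (0≢1+n (trans (sym eq) (unselected-leaf-leaf legal)))

      by-unselected : ∀ u → unselected [ leaf ℓ ] ≡ u → AtLeast (step (outcome u))
      by-unselected zero eq =
        step (outcome 0)
        , best centre centre-legal-after-leaf (Lasts⇒Value (lasts-leaf-centre eq)) (last-reply eq)
        , ⊑-refl _
      by-unselected (suc u) eq with ⊑-total (step (outcome (suc u))) (step (outcome u))
      ... | inj₁ centre⊑leaf =
        let ℓ′ , legal = another-leaf eq
        in  step (outcome u)
            , best (leaf ℓ′) legal (Lasts⇒Value (lasts-leaf-leaf′ eq legal))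
                   (replies eq centre⊑leaf (⊑-refl _))
            , centre⊑leaf
      ... | inj₂ leaf⊑centre =
        step (outcome (suc u))
        , best centre centre-legal-after-leaf (Lasts⇒Value (lasts-leaf-centre eq))
               (replies eq (⊑-refl _) leaf⊑centre)
        , ⊑-refl _

    leaf-value : AtLeast (step (outcome (unselected [ leaf ℓ ])))
    leaf-value = by-unselected _ refl

  star-value : Value (Star n) [] (outcome (suc n))
  star-value = best centre Closure-[] (Lasts⇒Value lasts-centre) replies
    where
    replies : ∀ w → Legal (Star n) [] w →
              Σ Result λ r → Value (Star n) [ w ] r × step r ⊑ outcome (suc n)
    replies centre   _ = outcome n , Lasts⇒Value lasts-centre , ⊑-refl _
    replies (leaf ℓ) _ =
      let r , value , le = leaf-value ℓ
      in  r , value , subst (λ k → step r ⊑ outcome (suc k)) (unselected-leaf ℓ) (step-antitone le)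

  no-two-leaf-openings : ∀ {ℓ ℓ′} → OptimalMove (Star n) [] (leaf ℓ) →
                         OptimalMove (Star n) [ leaf ℓ ] (leaf ℓ′) → ⊥
  no-two-leaf-openings {ℓ} {ℓ′} (_ , r₁ , v₁ , v₀) (legal , r₂ , v₂ , v₁′) =
    1+n≢n (trans (outcome-injective same-value) counted)
    where
    open ≡-Reasoning
    u = unselected (leaf ℓ′ ∷ [ leaf ℓ ])
    forced : Value (Star n) (leaf ℓ′ ∷ [ leaf ℓ ]) (outcome u)
    forced = Lasts⇒Value (lasts-leaf-leaf legal)
    same-value : outcome (suc n) ≡ outcome (suc (suc u))
    same-value = begin
      outcome (suc n)       ≡⟨ Value-unique star-value v₀ ⟩
      step r₁               ≡⟨ cong step (Value-unique v₁ v₁′) ⟩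
      step (step r₂)        ≡⟨ cong (step ∘ step) (Value-unique v₂ forced) ⟩
      outcome (suc (suc u)) ∎
    counted : suc (suc u) ≡ n
    counted = trans (cong suc (sym (unselected-leaf-leaf legal))) (unselected-leaf ℓ)

  centre-selected : ∀ {T} → OptimalPlay (Star n) [] T → centre ∈ T
  centre-selected (done closed)                                  = ⊥-elim (Closure-[] (closed centre))
  centre-selected (move centre _ play)                           = OptimalPlay⇒⊆ play (here refl)
  centre-selected (move (leaf _) _ (done closed))                = ⊥-elim (centre-legal-after-leaf (closed centre))
  centre-selected (move (leaf _) _ (move centre _ play))         = OptimalPlay⇒⊆ play (here refl)
  centre-selected (move (leaf _) first (move (leaf _) second _)) = ⊥-elim (no-two-leaf-openings first second)

  Star-AllSelected : AllSelectedUnderOptimalPlay (Star n)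
  Star-AllSelected = centre-opening , selected
    where
    centre-opening : ∃ (OptimalPlay (Star n) [])
    centre-opening =
      let T , play = Lasts⇒OptimalPlay lasts-centre
      in  T , move centre (Closure-[] , outcome n , Lasts⇒Value lasts-centre , star-value) play
    selected : ∀ T → OptimalPlay (Star n) [] T → ∀ z → z ∈ T
    selected _ play centre   = centre-selected play
    selected _ play (leaf ℓ) = Extreme-Closure⇒∈ leaf-extreme (OptimalPlay⇒Terminal play (leaf ℓ))

proposition1 : (n : ℕ) → n ≥ 1 →
    AllSelectedUnderOptimalPlay (K n) × AllSelectedUnderOptimalPlay (Star n)
proposition1 n _ = K-AllSelected n , Star-AllSelected n
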